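{- The non-commutative IPS polynomially simulates tree-like $\mathcal{F}$-$\mathcal{PC}$. That is, there is a polynomial $p$ such that for every field $\mathbb{F}$ and every collection $f_1,\ldots,f_m$ of arithmetic formulas over $\mathbb{F}$ in the variables $x_1,\ldots,x_n$: if there is a tree-like $\mathcal{F}$-$\mathcal{PC}$ refutation of $\{f_1,\ldots,f_m\}$ of size $S$, then, viewing each $f_j$ as a non-commutative formula (the order of the children of product gates taken as the order of multiplication), the system consisting of $f_1,\ldots,f_m$ together with the Boolean axioms $x_i(1-x_i)$ and the commutator axioms $x_ix_j-x_jx_i$ ($i<j$) has a non-commutative IPS refutation over $\mathbb{F}$ of size at most $p(S)$.
   Context: Arithmetic formulas are treated as syntactic ordered trees of fan-in at most two, with leaves labeled by variables or field elements and internal $+$/$\times$ gates. $\mathcal{F}$-$\mathcal{PC}$: a proof of $\Phi_\ell$ from $f_1,\ldots,f_m$ is a sequence of formulas $\Phi_1,\ldots,\Phi_\ell$ where each $\Phi_i$ is some $f_j$, or a Boolean axiom $x_r\cdot(1-x_r)$, or is derived from earlier lines by: Product ($\Phi\vdash x_r\cdot\Phi$), Addition ($\Phi,\Theta\vdash a\cdot\Phi+b\cdot\Theta$ for $a,b\in\mathbb{F}$), or by applying to a subformula one of the rewriting rules (in either direction) $0\cdot f\leftrightarrow 0$, $1\cdot f\leftrightarrow f$, $t\leftrightarrow\alpha$ for a variable-free formula $t$ computing $\alpha\in\mathbb{F}$, $f+g\leftrightarrow g+f$, $f\cdot g\leftrightarrow g\cdot f$, $f+(g+h)\leftrightarrow(f+g)+h$,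 $f\cdot(g\cdot h)\leftrightarrow(f\cdot g)\cdot h$, $f\cdot(g+h)\leftrightarrow(f\cdot g)+(f\cdot h)$. A refutation is a proof of the formula $1$; its size is the total size of its formulas. It is tree-like if every derived line is used at most once as a premise. Non-commutative IPS: for $F_1,\ldots,F_m\in\mathbb{F}\langle x_1,\ldots,x_n\rangle$ including Boolean and commutator axioms, a refutation is $\mathfrak{F}\in\mathbb{F}\langle\overline x,\overline y\rangle$ with $\mathfrak{F}(\overline x,\overline 0)=0$ and $\mathfrak{F}(\overline x,F_1,\ldots,F_m)=1$ as non-commutative polynomial identities; its size is the minimal number of nodes of a non-commutative formula computing it. -}

module Defs where

open import Level using (0ℓ)
open import Data.Nat as ℕ using (ℕ; zero; suc)
open import Data.Fin as Fin using (Fin; toℕ)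
open import Data.Fin.Properties using () renaming (_≟_ to _≟ᶠ_)
open import Data.List as List using (List; []; _∷_; _++_; length; filter)
open import Data.List.Membership.Propositional using (_∈_)
open import Data.Vec as Vec using (Vec; lookup; _∷ʳ_)
open import Data.Sum using (_⊎_; inj₁; inj₂)
open import Data.Product using (Σ; ∃; _×_; _,_)
open import Data.Maybe using (Maybe; just; nothing)
open import Relation.Binary.PropositionalEquality using (_≡_)
open import Relation.Nullary using (¬_; yes; no)
open import Algebra.Bundles using (CommutativeRing)

record Field : Set₁ where
  field
    commutativeRing : CommutativeRing 0ℓ 0ℓ
  open CommutativeRing commutativeRing public
  field
    0≉1     : ¬ (0# ≈ 1#)
    inverse : ∀ x → ¬ (x ≈ 0#) → Σ Carrier (λ y → x * y ≈ 1#)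

-- Polynomials p ∈ ℕ[X], given by coefficient lists (constant first).

evalPoly : List ℕ → ℕ → ℕ
evalPoly []       _ = 0
evalPoly (c ∷ cs) x = c ℕ.+ x ℕ.* evalPoly cs x

data Form (A : Set) (V : Set) : Set where
  var : V → Form A V
  cst : A → Form A V
  _⊕_ : Form A V → Form A V → Form A V
  _⊗_ : Form A V → Form A V → Form A V

infixl 6 _⊕_
infixl 7 _⊗_

size : ∀ {A V} → Form A V → ℕ
size (var _) = 1
size (cst _) = 1
size (f ⊕ g) = suc (size f ℕ.+ size g)
size (f ⊗ g) = suc (size f ℕ.+ size g)

subst : ∀ {A V W} → (V → Form A W) → Form A V → Form A W
subst σ (var v) = σ v
subst σ (cst a) = cst a
subst σ (f ⊕ g) = subst σ f ⊕ subst σ g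
subst σ (f ⊗ g) = subst σ f ⊗ subst σ g

module _ (𝔽 : Field) where
  open Field 𝔽 using (Carrier; _≈_; _+_; _*_; -_; 0#; 1#)

  F : Set → Set
  F V = Form Carrier V

  evalClosed : ∀ {V} → F V → Maybe Carrier
  evalClosed (var _) = nothing
  evalClosed (cst a) = just a
  evalClosed (f ⊕ g) with evalClosed f | evalClosed g
  ... | just a | just b = just (a + b)
  ... | _      | _      = nothing
  evalClosed (f ⊗ g) with evalClosed f | evalClosed g
  ... | just a | just b = just (a * b)
  ... | _      | _      = nothing

  -- F-PC rewriting rules (one direction) ...

  data Rule {V : Set} : F V → F V → Set where
    zero-mul : ∀ f → Rule (cst 0# ⊗ f) (cst 0#)
    one-mul  : ∀ f → Rule (cst 1# ⊗ f) f
    const    : ∀ t {β} α → evalClosed t ≡ just β → β ≈ α → Rule t (cst α)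
    +-comm   : ∀ f g → Rule (f ⊕ g) (g ⊕ f)
    *-comm   : ∀ f g → Rule (f ⊗ g) (g ⊗ f)
    +-assoc  : ∀ f g h → Rule (f ⊕ (g ⊕ h)) ((f ⊕ g) ⊕ h)
    *-assoc  : ∀ f g h → Rule (f ⊗ (g ⊗ h)) ((f ⊗ g) ⊗ h)
    distrib  : ∀ f g h → Rule (f ⊗ (g ⊕ h)) ((f ⊗ g) ⊕ (f ⊗ h))

  -- ... applied to a subformula, in either direction.
  data Rewrite {V : Set} : F V → F V → Set where
    fwd  : ∀ {f g} → Rule f g → Rewrite f g
    bwd  : ∀ {f g} → Rule g f → Rewrite f g
    ⊕ˡ   : ∀ {f f′} g → Rewrite f f′ → Rewrite (f ⊕ g) (f′ ⊕ g)
    ⊕ʳ   : ∀ f {g g′} → Rewrite g g′ → Rewrite (f ⊕ g) (f ⊕ g′)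
    ⊗ˡ   : ∀ {f f′} g → Rewrite f f′ → Rewrite (f ⊗ g) (f′ ⊗ g)
    ⊗ʳ   : ∀ f {g g′} → Rewrite g g′ → Rewrite (f ⊗ g) (f ⊗ g′)

  boolAx : ∀ {n} → Fin n → F (Fin n)
  boolAx r = var r ⊗ (cst 1# ⊕ (cst (- 1#) ⊗ var r))

  module _ {n m : ℕ} (fs : Vec (F (Fin n)) m) where

    data Just {k : ℕ} (prev : Vec (F (Fin n)) k) : F (Fin n) → Set where
      hyp  : (j : Fin m) → Just prev (lookup fs j)
      bool : (r : Fin n) → Just prev (boolAx r)
      prod : (i : Fin k) (r : Fin n) → Just prev (var r ⊗ lookup prev i)
      add  : (i i′ : Fin k) (a b : Carrier) →
             Just prev (cst a ⊗ lookup prev i ⊕ cst b ⊗ lookup prev i′)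
      rw   : (i : Fin k) {Φ : F (Fin n)} → Rewrite (lookup prev i) Φ → Just prev Φ

    premisesJ : ∀ {k prev Φ} → Just {k} prev Φ → List ℕ
    premisesJ (hyp _)       = []
    premisesJ (bool _)      = []
    premisesJ (prod i _)    = toℕ i ∷ []
    premisesJ (add i i′ _ _) = toℕ i ∷ toℕ i′ ∷ []
    premisesJ (rw i _)      = toℕ i ∷ []

    isDerived : ∀ {k prev Φ} → Just {k} prev Φ → Set
    isDerived (hyp _)  = Data.Empty.⊥ where import Data.Empty
    isDerived (bool _) = Data.Empty.⊥ where import Data.Empty
    isDerived _        = Data.Unit.⊤ where import Data.Unit

    -- a proof whose sequence of lines is `lines` (line 0 first)
    data Proof : {k : ℕ} → Vec (F (Fin n)) k → Set where
      []  : Proof Vec.[]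
      _▷_ : ∀ {k} {prev : Vec (F (Fin n)) k} {Φ} →
            Proof prev → Just prev Φ → Proof (prev ∷ʳ Φ)

    premises : ∀ {k} {ls : Vec (F (Fin n)) k} → Proof ls → List ℕ
    premises []      = []
    premises (P ▷ J) = premises P ++ premisesJ J

    Derived : ∀ {k} {ls : Vec (F (Fin n)) k} → Proof ls → ℕ → Set
    Derived []                   i = Data.Empty.⊥ where import Data.Empty
    Derived (_▷_ {k = k} P J) i with i ℕ.≟ k
    ... | yes _ = isDerived J
    ... | no  _ = Derived P i

    TreeLike : ∀ {k} {ls : Vec (F (Fin n)) k} → Proof ls → Set
    TreeLike P = ∀ i → Derived P i →
                 length (filter (ℕ._≟ i) (premises P)) ℕ.≤ 1

    proofSize : ∀ {k} → Vec (F (Fin n)) k → ℕ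
    proofSize ls = Vec.sum (Vec.map size ls)

    TreeLikeRefutation : ℕ → Set
    TreeLikeRefutation S =
      Σ ℕ λ k → Σ (Vec (F (Fin n)) (suc k)) λ ls →
        Σ (Proof ls) λ P → TreeLike P × Vec.last ls ≡ cst 1# × proofSize ls ≡ S

  -- Non-commutative polynomials computed by formulas: coefficient of
  -- each word (monomial) in the free algebra 𝔽⟨x_1,…,x_n⟩.

  splits : ∀ {X : Set} → List X → List (List X × List X)
  splits []       = ([] , []) ∷ []
  splits (x ∷ xs) = ([] , x ∷ xs) ∷ List.map (λ { (u , v) → (x ∷ u , v) }) (splits xs)

  sumF : List Carrier → Carrier
  sumF = List.foldr _+_ 0#

  coeff : ∀ {n} → F (Fin n) → List (Fin n) → Carrier
  coeff (var i) (j ∷ []) with i ≟ᶠ j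
  ... | yes _ = 1#
  ... | no  _ = 0#
  coeff (var i) _        = 0#
  coeff (cst a) []       = a
  coeff (cst a) (_ ∷ _)  = 0#
  coeff (f ⊕ g) w        = coeff f w + coeff g w
  coeff (f ⊗ g) w        =
    sumF (List.map (λ { (u , v) → coeff f u * coeff g v }) (splits w))

  _≐_ : ∀ {n} → F (Fin n) → F (Fin n) → Set
  f ≐ g = ∀ w → coeff f w ≈ coeff g w

  -- axiom indices: f_j (j < m), Boolean axioms (i < n),
  -- commutator axioms (i < j < n)
  Ax : ℕ → ℕ → Set
  Ax n m = Fin m ⊎ (Fin n ⊎ Σ (Fin n × Fin n) (λ { (i , j) → i Fin.< j }))

  commAx : ∀ {n} → Fin n → Fin n → F (Fin n)
  commAx i j = var i ⊗ var j ⊕ cst (- 1#) ⊗ (var j ⊗ var i)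

  axioms : ∀ {n m} → Vec (F (Fin n)) m → Ax n m → F (Fin n)
  axioms fs (inj₁ j)                  = lookup fs j
  axioms fs (inj₂ (inj₁ i))           = boolAx i
  axioms fs (inj₂ (inj₂ ((i , j) , _))) = commAx i j

  plugY : ∀ {n Y} → (Y → F (Fin n)) → F (Fin n ⊎ Y) → F (Fin n)
  plugY σ = subst λ { (inj₁ i) → var i ; (inj₂ y) → σ y }

  -- a non-commutative IPS refutation of the system fs + Boolean +
  -- commutator axioms, computed by a non-commutative formula of size ≤ s
  -- (the IPS size is the least size of a formula computing it)
  NCIPSRefutation : ∀ {n m} → Vec (F (Fin n)) m → ℕ → Set
  NCIPSRefutation {n} {m} fs s =
    Σ (F (Fin n ⊎ Ax n m)) λ 𝔉 →
      size 𝔉 ℕ.≤ s ×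
      plugY (λ _ → cst 0#) 𝔉 ≐ cst 0# ×
      plugY (axioms fs) 𝔉 ≐ cst 1#

module Submission where

-- Given a tree-like F-PC refutation with lines Φ_0, …, Φ_k = 1 we assign to
-- every line Φ a certificate: a non-commutative formula X(x, y) with
-- X(x, 0) = 0 and X(x, axioms) = Φ as non-commutative polynomials.  Axiom
-- lines are certified by their placeholder variable, Product and Addition
-- lines by the same operations on the premises' certificates, and a rewriting
-- step Φ ⟶ Φ′ by the certificate of Φ plus one of the difference Φ′ - Φ.
-- Every rewriting rule except commutativity of products is a non-commutative
-- identity (difference 0); for f·g ⟶ g·f the commutator fg - gf is expanded by
-- the Leibniz rule into commutator axioms, at quadratic cost in each factor.
-- Since the proof is tree-like, each derived certificate is copied into at
-- most one later certificate, so a weight argument bounds the certificate of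
-- the last line by (number of lines) · perLine S, which is polynomial in S.

open import Defs
open import Data.Nat using (ℕ)
open import Data.List using (List)
open import Data.Vec using (Vec)
open import Data.Fin using (Fin)
open import Data.Product using (Σ)

open import Level using (0ℓ)
open import Data.Nat as ℕ using (suc; _≤_; _<_; z≤n; s≤s)
import Data.Nat.Properties as ℕₚ
open import Data.Fin using (toℕ)
import Data.Fin as Fin
import Data.Fin.Properties as Finₚ
open import Data.List as List using ([]; _∷_)
import Data.List.Properties as Listₚ
import Data.Vec as Vec
import Data.Vec.Properties as Vecₚ
open import Data.Product using (_×_; _,_; proj₁; proj₂)
open import Data.Sum using (_⊎_; inj₁; inj₂)
open import Data.Maybe using (just; nothing)
open import Relation.Binary using (Setoid)
open import Relation.Binary.Definitions using (tri<; tri≈; tri>)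
open import Relation.Binary.PropositionalEquality as ≡ using (_≡_; refl)
import Relation.Binary.Reasoning.Setoid as SetoidReasoning
open import Algebra.Bundles using (CommutativeRing)
import Algebra.Properties.Ring as RingProperties
import Algebra.Properties.AbelianGroup as AbelianGroupProperties

private
  variable
    n : ℕ

-- Commutator certificates grow quadratically in each
-- argument, so a rewriting step costs at most rewriteBound of the rewritten
-- line and every line of the proof costs at most perLine S.
module SizeArithmetic where
  open import Data.Nat
  open import Data.Nat.Properties
  open import Data.Nat.Tactic.RingSolver using (solve-∀)
  open ≤-Reasoning

  sq : ℕ → ℕ
  sq s = s * s

  sq-mono : ∀ {s t} → s ≤ t → sq s ≤ sq t
  sq-mono s≤t = *-mono-≤ s≤t s≤t

  private
    quadratic-expansion : ∀ d a b →
      (3 + a + b + (3 + d) * (a * a) + (3 + d) * (b * b))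
        + (d + (5 + 2 * d) * a + (5 + 2 * d) * b + (6 + 2 * d) * (a * b))
      ≡ (3 + d) * ((1 + (a + b)) * (1 + (a + b)))
    quadratic-expansion = solve-∀

    ⊕-node-split : ∀ a b x y → 2 + a + b + suc (x + y) ≡ 3 + a + b + x + y
    ⊕-node-split = solve-∀

    regroupˡ : ∀ a b q → suc (a + q + b) ≡ suc (a + b) + q
    regroupˡ = solve-∀

    regroupʳ : ∀ a b q → suc (a + (b + q)) ≡ suc (a + b) + q
    regroupʳ = solve-∀

  -- the recurrence satisfied by the sizes of commutator certificates
  quadratic-growth : ∀ {c} a b {x y} → 3 ≤ c → x ≤ c * sq a → y ≤ c * sq b →
                     3 + a + b + x + y ≤ c * sq (suc (a + b))
  quadratic-growth {suc (suc (suc d))} a b (s≤s (s≤s (s≤s _))) x≤ y≤ = begin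
    3 + a + b + _ + _                            ≤⟨ +-mono-≤ (+-monoʳ-≤ (3 + a + b) x≤) y≤ ⟩
    3 + a + b + (3 + d) * sq a + (3 + d) * sq b  ≤⟨ m≤m+n _ _ ⟩
    _                                            ≡⟨ quadratic-expansion d a b ⟩
    (3 + d) * sq (suc (a + b))                   ∎

  -- the factor 3 · sq |g| used for commutator certificates of ⟦ f , g ⟧
  three≤ : ∀ {s} → 1 ≤ s → 3 ≤ 3 * sq s
  three≤ 1≤s = *-monoʳ-≤ 3 (sq-mono 1≤s)

  -- sizes of the nodes of a commutator certificate, in terms of the sizes
  -- a, b of the two subformulas and x, y of their certificates
  ⊕-node : ∀ a b x y → suc (x + y) ≤ 3 + a + b + x + y
  ⊕-node a b x y = begin
    suc (x + y)                 ≤⟨ m≤n+m (suc (x + y)) (2 + a + b) ⟩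
    2 + a + b + suc (x + y)     ≡⟨ ⊕-node-split a b x y ⟩
    3 + a + b + x + y           ∎

  ⊗-nodeʳ : ∀ a b x y → suc (suc (x + b) + suc (a + y)) ≡ 3 + a + b + x + y
  ⊗-nodeʳ = solve-∀

  ⊗-nodeˡ : ∀ a b x y → suc (suc (a + y) + suc (x + b)) ≡ 3 + a + b + x + y
  ⊗-nodeˡ = solve-∀

  -- bound on the certificate of a swap f·g ⟶ g·f of size s
  quartic : ℕ → ℕ
  quartic s = 3 * sq s * sq s

  quartic-mono : ∀ {s t} → s ≤ t → quartic s ≤ quartic t
  quartic-mono s≤t = *-mono-≤ (*-monoʳ-≤ 3 (sq-mono s≤t)) (sq-mono s≤t)

  1≤quartic : ∀ {s} → 1 ≤ s → 1 ≤ quartic s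
  1≤quartic 1≤s = ≤-trans (s≤s z≤n) (quartic-mono 1≤s)

  rewriteBound : ℕ → ℕ
  rewriteBound s = s + quartic s

  rewriteBound-mono : ∀ {s t} → s ≤ t → rewriteBound s ≤ rewriteBound t
  rewriteBound-mono s≤t = +-mono-≤ s≤t (quartic-mono s≤t)

  rewriteBound-⊗ˡ : ∀ a b {x} → x ≤ rewriteBound a → suc (x + b) ≤ rewriteBound (suc (a + b))
  rewriteBound-⊗ˡ a b {x} x≤ = begin
    suc (x + b)                      ≤⟨ s≤s (+-monoˡ-≤ b x≤) ⟩
    suc (a + quartic a + b)          ≡⟨ regroupˡ a b (quartic a) ⟩
    suc (a + b) + quartic a          ≤⟨ +-monoʳ-≤ (suc (a + b)) (quartic-mono (≤-trans (m≤m+n a b) (n≤1+n _))) ⟩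
    rewriteBound (suc (a + b))       ∎

  rewriteBound-⊗ʳ : ∀ a b {x} → x ≤ rewriteBound b → suc (a + x) ≤ rewriteBound (suc (a + b))
  rewriteBound-⊗ʳ a b {x} x≤ = begin
    suc (a + x)                      ≤⟨ s≤s (+-monoʳ-≤ a x≤) ⟩
    suc (a + (b + quartic b))        ≡⟨ regroupʳ a b (quartic b) ⟩
    suc (a + b) + quartic b          ≤⟨ +-monoʳ-≤ (suc (a + b)) (quartic-mono (≤-trans (m≤n+m b a) (n≤1+n _))) ⟩
    rewriteBound (suc (a + b))       ∎

  -- size of a line certificate beyond the certificates of its premises
  axiom-overhead : ∀ R → 1 ≤ R + 5 + 0
  axiom-overhead R = ≤-trans (s≤s z≤n) (≤-trans (m≤n+m 5 R) (m≤m+n (R + 5) 0))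

  product-overhead : ∀ R x → suc (suc x) ≤ R + 5 + (x + 0)
  product-overhead R x = ≤-trans (m≤n+m _ (R + 3)) (≤-reflexive (split R x))
    where
    split : ∀ R x → R + 3 + suc (suc x) ≡ R + 5 + (x + 0)
    split = solve-∀

  sum-overhead : ∀ R x y → suc (suc (suc x) + suc (suc y)) ≤ R + 5 + (x + (y + 0))
  sum-overhead R x y = ≤-trans (m≤n+m _ R) (≤-reflexive (split R x y))
    where
    split : ∀ R x y → R + suc (suc (suc x) + suc (suc y)) ≡ R + 5 + (x + (y + 0))
    split = solve-∀

  rewrite-overhead : ∀ {R r} x → r ≤ R → suc (x + r) ≤ R + 5 + (x + 0)
  rewrite-overhead {R} {r} x r≤R = begin
    suc (x + r)           ≤⟨ s≤s (+-monoʳ-≤ x r≤R) ⟩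
    suc (x + R)           ≤⟨ m≤n+m _ 4 ⟩
    4 + suc (x + R)       ≡⟨ split R x ⟩
    R + 5 + (x + 0)       ∎
    where
    split : ∀ R x → 4 + suc (x + R) ≡ R + 5 + (x + 0)
    split = solve-∀

  perLine : ℕ → ℕ
  perLine S = rewriteBound S + 7

  -- the budget of k lines, plus the new line's overhead and two premises
  budget-step : ∀ k R → k * (R + 7) + 2 + (R + 5) ≡ suc k * (R + 7)
  budget-step = solve-∀

  +-rotate : ∀ t a s → t + (a + s) ≡ (t + s) + a
  +-rotate = solve-∀

  -- the simulating polynomial 7 S + S² + 3 S⁵
  complexity : List ℕ
  complexity = 0 ∷ 7 ∷ 1 ∷ 0 ∷ 0 ∷ 3 ∷ []

  complexity-eval : ∀ S → S * perLine S ≡ evalPoly complexity S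
  complexity-eval = expanded
    where
    expanded : ∀ S → S * (S + 3 * (S * S) * (S * S) + 7)
                   ≡ 0 + S * (7 + S * (1 + S * (0 + S * (0 + S * (3 + S * 0)))))
    expanded = solve-∀

-- Rearrangements in a commutative ring, discharged by the ring solver.  Negated
-- terms are passed as separate variables, since the solver fails on -_ here.
module RingIdentities (R : CommutativeRing 0ℓ 0ℓ) where
  open import Tactic.RingSolver using (solve-∀)
  open import Tactic.RingSolver.Core.AlmostCommutativeRing
    using (AlmostCommutativeRing; fromCommutativeRing)
  private
    ring : AlmostCommutativeRing 0ℓ 0ℓ
    ring = fromCommutativeRing R (λ _ → nothing)
  open AlmostCommutativeRing ring

  +-*-interchangeʳ : ∀ a b c p q → (a + b) * c + (p + q) ≈ (a * c + p) + (b * c + q)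
  +-*-interchangeʳ = solve-∀ ring

  +-*-interchangeˡ : ∀ a b c p q → c * (a + b) + (p + q) ≈ (c * a + p) + (c * b + q)
  +-*-interchangeˡ = solve-∀ ring

  *-+-regroup : ∀ a x d e → a * x + (a * d + e) ≈ a * (x + d) + e
  *-+-regroup = solve-∀ ring

  +-swap-front : ∀ a b c → a + (b + c) ≈ b + (a + c)
  +-swap-front = solve-∀ ring

  +-medial : ∀ a b c d → (a + b) + (c + d) ≈ (a + c) + (b + d)
  +-medial = solve-∀ ring

  +-exchange : ∀ a b c d → (a + b) + (c + d) ≈ (a + d) + (c + b)
  +-exchange = solve-∀ ring

module Series (𝔽 : Field) where
  module R = Field 𝔽
  open R using (Carrier; _≈_; _+_; _*_; 0#)
  open RingIdentities R.commutativeRing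
  open SetoidReasoning R.setoid

  Series : ℕ → Set
  Series n = List (Fin n) → Carrier

  infix 4 _≋_
  _≋_ : Series n → Series n → Set
  c ≋ d = ∀ w → c w ≈ d w

  conv : Series n → Series n → Series n
  conv c d w = sumF 𝔽 (List.map (λ { (u , v) → c u * d v }) (splits 𝔽 w))

  after : Fin n → Series n → Series n
  after x c u = c (x ∷ u)

  constant : Carrier → Series n
  constant a = coeff 𝔽 (cst a)

  conv-[] : (c d : Series n) → conv c d [] ≈ c [] * d []
  conv-[] c d = R.+-identityʳ _

  conv-∷ : (c d : Series n) (x : Fin n) (w : List (Fin n)) →
           conv c d (x ∷ w) ≡ c [] * d (x ∷ w) + conv (after x c) d w
  conv-∷ c d x w = ≡.cong (λ l → c [] * d (x ∷ w) + sumF 𝔽 l) (≡.sym (Listₚ.map-∘ (splits 𝔽 w)))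

  conv-cong : {c c′ d d′ : Series n} → c ≋ c′ → d ≋ d′ → conv c d ≋ conv c′ d′
  conv-cong c≋ d≋ [] = R.+-cong (R.*-cong (c≋ []) (d≋ [])) R.refl
  conv-cong {c = c} {c′} {d} {d′} c≋ d≋ (x ∷ w) = begin
    conv c d (x ∷ w)                         ≡⟨ conv-∷ c d x w ⟩
    c [] * d (x ∷ w) + conv (after x c) d w
      ≈⟨ R.+-cong (R.*-cong (c≋ []) (d≋ (x ∷ w))) (conv-cong (λ u → c≋ (x ∷ u)) d≋ w) ⟩
    c′ [] * d′ (x ∷ w) + conv (after x c′) d′ w ≡⟨ conv-∷ c′ d′ x w ⟨
    conv c′ d′ (x ∷ w)                       ∎

  conv-+ˡ : (c c′ d : Series n) → conv (λ u → c u + c′ u) d ≋ (λ w → conv c d w + conv c′ d w)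
  conv-+ˡ c c′ d [] = begin
    conv (λ u → c u + c′ u) d []  ≈⟨ conv-[] (λ u → c u + c′ u) d ⟩
    (c [] + c′ []) * d []         ≈⟨ R.distribʳ _ _ _ ⟩
    c [] * d [] + c′ [] * d []    ≈⟨ R.+-cong (conv-[] c d) (conv-[] c′ d) ⟨
    conv c d [] + conv c′ d []    ∎
  conv-+ˡ c c′ d (x ∷ w) = begin
    conv (λ u → c u + c′ u) d (x ∷ w)   ≡⟨ conv-∷ _ d x w ⟩
    (c [] + c′ []) * d (x ∷ w) + conv (λ u → c (x ∷ u) + c′ (x ∷ u)) d w
      ≈⟨ R.+-cong R.refl (conv-+ˡ (after x c) (after x c′) d w) ⟩
    (c [] + c′ []) * d (x ∷ w) + (conv (after x c) d w + conv (after x c′) d w)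
      ≈⟨ +-*-interchangeʳ _ _ _ _ _ ⟩
    (c [] * d (x ∷ w) + conv (after x c) d w) + (c′ [] * d (x ∷ w) + conv (after x c′) d w)
      ≡⟨ ≡.cong₂ _+_ (conv-∷ c d x w) (conv-∷ c′ d x w) ⟨
    conv c d (x ∷ w) + conv c′ d (x ∷ w) ∎

  conv-+ʳ : (c d d′ : Series n) → conv c (λ u → d u + d′ u) ≋ (λ w → conv c d w + conv c d′ w)
  conv-+ʳ c d d′ [] = begin
    conv c (λ u → d u + d′ u) []  ≈⟨ conv-[] c (λ u → d u + d′ u) ⟩
    c [] * (d [] + d′ [])         ≈⟨ R.distribˡ _ _ _ ⟩
    c [] * d [] + c [] * d′ []    ≈⟨ R.+-cong (conv-[] c d) (conv-[] c d′) ⟨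
    conv c d [] + conv c d′ []    ∎
  conv-+ʳ c d d′ (x ∷ w) = begin
    conv c (λ u → d u + d′ u) (x ∷ w)   ≡⟨ conv-∷ c _ x w ⟩
    c [] * (d (x ∷ w) + d′ (x ∷ w)) + conv (after x c) (λ u → d u + d′ u) w
      ≈⟨ R.+-cong R.refl (conv-+ʳ (after x c) d d′ w) ⟩
    c [] * (d (x ∷ w) + d′ (x ∷ w)) + (conv (after x c) d w + conv (after x c) d′ w)
      ≈⟨ +-*-interchangeˡ _ _ _ _ _ ⟩
    (c [] * d (x ∷ w) + conv (after x c) d w) + (c [] * d′ (x ∷ w) + conv (after x c) d′ w)
      ≡⟨ ≡.cong₂ _+_ (conv-∷ c d x w) (conv-∷ c d′ x w) ⟨
    conv c d (x ∷ w) + conv c d′ (x ∷ w) ∎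

  conv-scaleˡ : (k : Carrier) (c d : Series n) → conv (λ u → k * c u) d ≋ (λ w → k * conv c d w)
  conv-scaleˡ k c d [] = begin
    conv (λ u → k * c u) d []  ≈⟨ conv-[] (λ u → k * c u) d ⟩
    (k * c []) * d []          ≈⟨ R.*-assoc _ _ _ ⟩
    k * (c [] * d [])          ≈⟨ R.*-cong R.refl (conv-[] c d) ⟨
    k * conv c d []            ∎
  conv-scaleˡ k c d (x ∷ w) = begin
    conv (λ u → k * c u) d (x ∷ w)   ≡⟨ conv-∷ _ d x w ⟩
    (k * c []) * d (x ∷ w) + conv (λ u → k * c (x ∷ u)) d w
      ≈⟨ R.+-cong (R.*-assoc _ _ _) (conv-scaleˡ k (after x c) d w) ⟩
    k * (c [] * d (x ∷ w)) + k * conv (after x c) d w ≈⟨ R.distribˡ _ _ _ ⟨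
    k * (c [] * d (x ∷ w) + conv (after x c) d w)     ≡⟨ ≡.cong (k *_) (conv-∷ c d x w) ⟨
    k * conv c d (x ∷ w)                              ∎

  conv-zeroˡ : (d : Series n) → conv (λ _ → 0#) d ≋ (λ _ → 0#)
  conv-zeroˡ d [] = R.trans (conv-[] (λ _ → 0#) d) (R.zeroˡ _)
  conv-zeroˡ d (x ∷ w) = begin
    conv (λ _ → 0#) d (x ∷ w)              ≡⟨ conv-∷ _ d x w ⟩
    0# * d (x ∷ w) + conv (λ _ → 0#) d w   ≈⟨ R.+-cong (R.zeroˡ _) (conv-zeroˡ d w) ⟩
    0# + 0#                                ≈⟨ R.+-identityʳ 0# ⟩
    0#                                     ∎

  conv-constˡ : (a : Carrier) (d : Series n) → conv (constant a) d ≋ (λ w → a * d w)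
  conv-constˡ a d [] = conv-[] (constant a) d
  conv-constˡ a d (x ∷ w) = begin
    conv (constant a) d (x ∷ w)                  ≡⟨ conv-∷ _ d x w ⟩
    a * d (x ∷ w) + conv (λ _ → 0#) d w       ≈⟨ R.+-cong R.refl (conv-zeroˡ d w) ⟩
    a * d (x ∷ w) + 0#                        ≈⟨ R.+-identityʳ _ ⟩
    a * d (x ∷ w)                             ∎

  conv-constʳ : (a : Carrier) (c : Series n) → conv c (constant a) ≋ (λ w → c w * a)
  conv-constʳ a c [] = conv-[] c (constant a)
  conv-constʳ a c (x ∷ w) = begin
    conv c (constant a) (x ∷ w)                     ≡⟨ conv-∷ c _ x w ⟩
    c [] * 0# + conv (after x c) (constant a) w     ≈⟨ R.+-cong (R.zeroʳ _) (conv-constʳ a (after x c) w) ⟩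
    0# + c (x ∷ w) * a                           ≈⟨ R.+-identityˡ _ ⟩
    c (x ∷ w) * a                                ∎

  -- associativity: expanding the first letter of the word reduces it to the
  -- same statement for the series following that letter
  conv-assoc : (c d e : Series n) → conv (conv c d) e ≋ conv c (conv d e)
  conv-assoc c d e [] = begin
    conv (conv c d) e []        ≈⟨ conv-[] (conv c d) e ⟩
    conv c d [] * e []          ≈⟨ R.*-cong (conv-[] c d) R.refl ⟩
    (c [] * d []) * e []        ≈⟨ R.*-assoc _ _ _ ⟩
    c [] * (d [] * e [])        ≈⟨ R.*-cong R.refl (conv-[] d e) ⟨
    c [] * conv d e []          ≈⟨ conv-[] c (conv d e) ⟨
    conv c (conv d e) []        ∎
  conv-assoc c d e (x ∷ w) = begin
    conv (conv c d) e (x ∷ w)   ≡⟨ conv-∷ _ e x w ⟩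
    conv c d [] * e (x ∷ w) + conv (after x (conv c d)) e w
      ≈⟨ R.+-cong (R.*-cong (conv-[] c d) R.refl)
                  (conv-cong (λ u → R.reflexive (conv-∷ c d x u)) (λ _ → R.refl) w) ⟩
    (c [] * d []) * e (x ∷ w) + conv (λ u → c [] * d (x ∷ u) + conv (after x c) d u) e w
      ≈⟨ R.+-cong R.refl (conv-+ˡ _ _ e w) ⟩
    (c [] * d []) * e (x ∷ w) + (conv (λ u → c [] * after x d u) e w + conv (conv (after x c) d) e w)
      ≈⟨ R.+-cong R.refl (R.+-cong (conv-scaleˡ (c []) (after x d) e w) (conv-assoc (after x c) d e w)) ⟩
    (c [] * d []) * e (x ∷ w) + (c [] * conv (after x d) e w + conv (after x c) (conv d e) w)
      ≈⟨ R.trans (R.+-cong (R.*-assoc _ _ _) R.refl) (*-+-regroup _ _ _ _) ⟩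
    c [] * (d [] * e (x ∷ w) + conv (after x d) e w) + conv (after x c) (conv d e) w
      ≡⟨ ≡.cong (λ z → c [] * z + conv (after x c) (conv d e) w) (conv-∷ d e x w) ⟨
    c [] * conv d e (x ∷ w) + conv (after x c) (conv d e) w
      ≡⟨ conv-∷ c _ x w ⟨
    conv c (conv d e) (x ∷ w) ∎

module Polynomials (𝔽 : Field) {n : ℕ} where
  open Series 𝔽
  open R using (Carrier; _≈_; _+_; _*_; -_; 0#; 1#)
  open RingIdentities R.commutativeRing
  private
    module Ring = RingProperties R.ring
    module +-Group = AbelianGroupProperties R.+-abelianGroup

  Fm : Set
  Fm = F 𝔽 (Fin n)

  co : Fm → Series n
  co = coeff 𝔽

  infix 4 _≃_
  record _≃_ (f g : Fm) : Set where
    constructor coeffwise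
    field coeffs : co f ≋ co g
  open _≃_ public

  ≃-setoid : Setoid 0ℓ 0ℓ
  ≃-setoid = record
    { Carrier       = Fm
    ; _≈_           = _≃_
    ; isEquivalence = record
      { refl  = coeffwise λ _ → R.refl
      ; sym   = λ p → coeffwise λ w → R.sym (coeffs p w)
      ; trans = λ p q → coeffwise λ w → R.trans (coeffs p w) (coeffs q w)
      }
    }
  open Setoid ≃-setoid public using ()
    renaming (refl to ≃-refl; sym to ≃-sym; trans to ≃-trans; reflexive to ≡⇒≃)

  constant-0# : (w : List (Fin n)) → constant 0# w ≈ 0#
  constant-0# []      = R.refl
  constant-0# (_ ∷ _) = R.refl

  ⊕-cong : ∀ {f f′ g g′} → f ≃ f′ → g ≃ g′ → f ⊕ g ≃ f′ ⊕ g′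
  ⊕-cong p q = coeffwise λ w → R.+-cong (coeffs p w) (coeffs q w)

  ⊗-cong : ∀ {f f′ g g′} → f ≃ f′ → g ≃ g′ → f ⊗ g ≃ f′ ⊗ g′
  ⊗-cong p q = coeffwise (conv-cong (coeffs p) (coeffs q))

  ⊕-comm : ∀ f g → f ⊕ g ≃ g ⊕ f
  ⊕-comm f g = coeffwise λ w → R.+-comm _ _

  ⊕-assoc : ∀ f g h → (f ⊕ g) ⊕ h ≃ f ⊕ (g ⊕ h)
  ⊕-assoc f g h = coeffwise λ w → R.+-assoc _ _ _

  ⊗-assoc : ∀ f g h → (f ⊗ g) ⊗ h ≃ f ⊗ (g ⊗ h)
  ⊗-assoc f g h = coeffwise (conv-assoc (co f) (co g) (co h))

  ⊗-distribˡ : ∀ f g h → f ⊗ (g ⊕ h) ≃ f ⊗ g ⊕ f ⊗ h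
  ⊗-distribˡ f g h = coeffwise (conv-+ʳ (co f) (co g) (co h))

  ⊗-distribʳ : ∀ f g h → (g ⊕ h) ⊗ f ≃ g ⊗ f ⊕ h ⊗ f
  ⊗-distribʳ f g h = coeffwise (conv-+ˡ (co g) (co h) (co f))

  ⊗-zeroˡ : ∀ f → cst 0# ⊗ f ≃ cst 0#
  ⊗-zeroˡ f = coeffwise λ w → R.trans (conv-constˡ 0# (co f) w)
                                      (R.trans (R.zeroˡ _) (R.sym (constant-0# w)))

  ⊗-zeroʳ : ∀ f → f ⊗ cst 0# ≃ cst 0#
  ⊗-zeroʳ f = coeffwise λ w → R.trans (conv-constʳ 0# (co f) w)
                                      (R.trans (R.zeroʳ _) (R.sym (constant-0# w)))

  ⊗-identityˡ : ∀ f → cst 1# ⊗ f ≃ f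
  ⊗-identityˡ f = coeffwise λ w → R.trans (conv-constˡ 1# (co f) w) (R.*-identityˡ _)

  cst-central : ∀ a f → cst a ⊗ f ≃ f ⊗ cst a
  cst-central a f = coeffwise λ w →
    R.trans (conv-constˡ a (co f) w) (R.trans (R.*-comm _ _) (R.sym (conv-constʳ a (co f) w)))

  closed-value : ∀ t {β} → evalClosed 𝔽 t ≡ just β → t ≃ cst β
  closed-value (var _) ()
  closed-value (cst a) refl = ≃-refl
  closed-value (f ⊕ g) e with evalClosed 𝔽 f in ef | evalClosed 𝔽 g in eg
  closed-value (f ⊕ g) refl | just a | just b =
    ≃-trans (⊕-cong (closed-value f ef) (closed-value g eg))
            (coeffwise λ { [] → R.refl ; (_ ∷ _) → R.+-identityʳ 0# })
  closed-value (f ⊗ g) e with evalClosed 𝔽 f in ef | evalClosed 𝔽 g in eg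
  closed-value (f ⊗ g) refl | just a | just b =
    ≃-trans (⊗-cong (closed-value f ef) (closed-value g eg))
            (coeffwise λ w → R.trans (conv-constˡ a (constant b) w) (scaled w))
    where
    scaled : ∀ w → a * constant b w ≈ constant (a * b) w
    scaled []      = R.refl
    scaled (_ ∷ _) = R.zeroʳ a

  ⊕-identityʳ : ∀ f → f ⊕ cst 0# ≃ f
  ⊕-identityʳ f = coeffwise λ w → R.trans (R.+-cong R.refl (constant-0# w)) (R.+-identityʳ _)

  ⊕-identityˡ : ∀ f → cst 0# ⊕ f ≃ f
  ⊕-identityˡ f = ≃-trans (⊕-comm (cst 0#) f) (⊕-identityʳ f)

  neg : Fm → Fm
  neg h = cst (- 1#) ⊗ h

  infixl 6 _⊖_
  _⊖_ : Fm → Fm → Fm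
  f ⊖ g = f ⊕ neg g

  ⟦_,_⟧ : Fm → Fm → Fm
  ⟦ f , g ⟧ = f ⊗ g ⊖ g ⊗ f

  ⊖-cong : ∀ {f f′ g g′} → f ≃ f′ → g ≃ g′ → f ⊖ g ≃ f′ ⊖ g′
  ⊖-cong p q = ⊕-cong p (⊗-cong ≃-refl q)

  module _ where
    open SetoidReasoning R.setoid

    co-neg : ∀ h w → co (neg h) w ≈ - co h w
    co-neg h w = R.trans (conv-constˡ (- 1#) (co h) w) (Ring.-1*x≈-x _)

    co-⊖ : ∀ f g w → co (f ⊖ g) w ≈ co f w + - co g w
    co-⊖ f g w = R.+-cong R.refl (co-neg g w)

    +-cancel : ∀ a c → a + (c + - c) ≈ a
    +-cancel a c = R.trans (R.+-cong R.refl (R.-‿inverseʳ c)) (R.+-identityʳ a)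

    -‿+ : ∀ a b → - (a + b) ≈ - a + - b
    -‿+ a b = R.sym (+-Group.⁻¹-∙-comm a b)

    ⊖-zero : ∀ {f g} → f ≃ g → f ⊖ g ≃ cst 0#
    ⊖-zero {f} {g} p = coeffwise λ w → begin
      co (f ⊖ g) w         ≈⟨ co-⊖ f g w ⟩
      co f w + - co g w    ≈⟨ R.+-cong (coeffs p w) R.refl ⟩
      co g w + - co g w    ≈⟨ R.-‿inverseʳ _ ⟩
      0#                   ≈⟨ constant-0# w ⟨
      constant 0# w        ∎

    ⊕-⊖-cancel : ∀ f g → f ⊕ (g ⊖ f) ≃ g
    ⊕-⊖-cancel f g = coeffwise λ w → begin
      co f w + co (g ⊖ f) w          ≈⟨ R.+-cong R.refl (co-⊖ g f w) ⟩
      co f w + (co g w + - co f w)   ≈⟨ +-swap-front _ _ _ ⟩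
      co g w + (co f w + - co f w)   ≈⟨ +-cancel _ _ ⟩
      co g w                         ∎

    ⊖-telescope : ∀ f g h → (f ⊖ h) ⊕ (h ⊖ g) ≃ f ⊖ g
    ⊖-telescope f g h = coeffwise λ w → begin
      co (f ⊖ h) w + co (h ⊖ g) w                    ≈⟨ R.+-cong (co-⊖ f h w) (co-⊖ h g w) ⟩
      (co f w + - co h w) + (co h w + - co g w)      ≈⟨ +-exchange _ _ _ _ ⟩
      (co f w + - co g w) + (co h w + - co h w)      ≈⟨ +-cancel _ _ ⟩
      co f w + - co g w                              ≈⟨ co-⊖ f g w ⟨
      co (f ⊖ g) w                                   ∎

    ⊖-medial : ∀ f f′ g g′ → (f ⊕ f′) ⊖ (g ⊕ g′) ≃ (f ⊖ g) ⊕ (f′ ⊖ g′)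
    ⊖-medial f f′ g g′ = coeffwise λ w → begin
      co ((f ⊕ f′) ⊖ (g ⊕ g′)) w                        ≈⟨ co-⊖ (f ⊕ f′) (g ⊕ g′) w ⟩
      (co f w + co f′ w) + - (co g w + co g′ w)        ≈⟨ R.+-cong R.refl (-‿+ _ _) ⟩
      (co f w + co f′ w) + (- co g w + - co g′ w)      ≈⟨ +-medial _ _ _ _ ⟩
      (co f w + - co g w) + (co f′ w + - co g′ w)      ≈⟨ R.+-cong (co-⊖ f g w) (co-⊖ f′ g′ w) ⟨
      co (f ⊖ g) w + co (f′ ⊖ g′) w                    ∎

    ⊖-flip : ∀ f g → f ⊖ g ≃ neg (g ⊖ f)
    ⊖-flip f g = coeffwise λ w → begin
      co (f ⊖ g) w            ≈⟨ co-⊖ f g w ⟩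
      co f w + - co g w       ≈⟨ +-Group.⁻¹-anti-homo‿- _ _ ⟨
      - (co g w + - co f w)   ≈⟨ R.-‿cong (co-⊖ g f w) ⟨
      - co (g ⊖ f) w          ≈⟨ co-neg (g ⊖ f) w ⟨
      co (neg (g ⊖ f)) w      ∎

  ⊖-cancelʳ : ∀ f g h → (f ⊕ h) ⊖ (g ⊕ h) ≃ f ⊖ g
  ⊖-cancelʳ f g h =
    ≃-trans (⊖-medial f h g h) (≃-trans (⊕-cong ≃-refl (⊖-zero {h} ≃-refl)) (⊕-identityʳ (f ⊖ g)))

  ⊖-cancelˡ : ∀ f g h → (h ⊕ f) ⊖ (h ⊕ g) ≃ f ⊖ g
  ⊖-cancelˡ f g h =
    ≃-trans (⊖-medial h f h g) (≃-trans (⊕-cong (⊖-zero {h} ≃-refl) ≃-refl) (⊕-identityˡ (f ⊖ g)))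

  module _ where
    open SetoidReasoning ≃-setoid

    neg-⊗ʳ : ∀ f g → f ⊗ neg g ≃ neg (f ⊗ g)
    neg-⊗ʳ f g = begin
      f ⊗ (cst (- 1#) ⊗ g)     ≈⟨ ⊗-assoc f (cst (- 1#)) g ⟨
      (f ⊗ cst (- 1#)) ⊗ g     ≈⟨ ⊗-cong (cst-central (- 1#) f) ≃-refl ⟨
      (cst (- 1#) ⊗ f) ⊗ g     ≈⟨ ⊗-assoc (cst (- 1#)) f g ⟩
      cst (- 1#) ⊗ (f ⊗ g)     ∎

    ⊗-⊖-distribʳ : ∀ f g h → (f ⊖ g) ⊗ h ≃ f ⊗ h ⊖ g ⊗ h
    ⊗-⊖-distribʳ f g h = ≃-trans (⊗-distribʳ h f (neg g)) (⊕-cong ≃-refl (⊗-assoc (cst (- 1#)) g h))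

    ⊗-⊖-distribˡ : ∀ f g h → h ⊗ (f ⊖ g) ≃ h ⊗ f ⊖ h ⊗ g
    ⊗-⊖-distribˡ f g h = ≃-trans (⊗-distribˡ h f (neg g)) (⊕-cong ≃-refl (neg-⊗ʳ h g))

    comm-⊕ˡ : ∀ f f′ g → ⟦ f ⊕ f′ , g ⟧ ≃ ⟦ f , g ⟧ ⊕ ⟦ f′ , g ⟧
    comm-⊕ˡ f f′ g =
      ≃-trans (⊖-cong (⊗-distribʳ g f f′) (⊗-distribˡ g f f′)) (⊖-medial (f ⊗ g) (f′ ⊗ g) (g ⊗ f) (g ⊗ f′))

    comm-⊕ʳ : ∀ f g g′ → ⟦ f , g ⊕ g′ ⟧ ≃ ⟦ f , g ⟧ ⊕ ⟦ f , g′ ⟧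
    comm-⊕ʳ f g g′ =
      ≃-trans (⊖-cong (⊗-distribˡ f g g′) (⊗-distribʳ f g g′)) (⊖-medial (f ⊗ g) (f ⊗ g′) (g ⊗ f) (g′ ⊗ f))

    comm-⊗ˡ : ∀ f f′ g → ⟦ f ⊗ f′ , g ⟧ ≃ f ⊗ ⟦ f′ , g ⟧ ⊕ ⟦ f , g ⟧ ⊗ f′
    comm-⊗ˡ f f′ g = ≃-sym (begin
      f ⊗ ⟦ f′ , g ⟧ ⊕ ⟦ f , g ⟧ ⊗ f′
        ≈⟨ ⊕-cong (⊗-⊖-distribˡ (f′ ⊗ g) (g ⊗ f′) f) (⊗-⊖-distribʳ (f ⊗ g) (g ⊗ f) f′) ⟩
      (f ⊗ (f′ ⊗ g) ⊖ f ⊗ (g ⊗ f′)) ⊕ ((f ⊗ g) ⊗ f′ ⊖ (g ⊗ f) ⊗ f′)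
        ≈⟨ ⊕-cong (⊖-cong (≃-sym (⊗-assoc f f′ g)) ≃-refl) (⊖-cong (⊗-assoc f g f′) (⊗-assoc g f f′)) ⟩
      ((f ⊗ f′) ⊗ g ⊖ f ⊗ (g ⊗ f′)) ⊕ (f ⊗ (g ⊗ f′) ⊖ g ⊗ (f ⊗ f′))
        ≈⟨ ⊖-telescope ((f ⊗ f′) ⊗ g) (g ⊗ (f ⊗ f′)) (f ⊗ (g ⊗ f′)) ⟩
      ⟦ f ⊗ f′ , g ⟧ ∎)

    comm-⊗ʳ : ∀ f g g′ → ⟦ f , g ⊗ g′ ⟧ ≃ ⟦ f , g ⟧ ⊗ g′ ⊕ g ⊗ ⟦ f , g′ ⟧
    comm-⊗ʳ f g g′ = ≃-sym (begin
      ⟦ f , g ⟧ ⊗ g′ ⊕ g ⊗ ⟦ f , g′ ⟧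
        ≈⟨ ⊕-cong (⊗-⊖-distribʳ (f ⊗ g) (g ⊗ f) g′) (⊗-⊖-distribˡ (f ⊗ g′) (g′ ⊗ f) g) ⟩
      ((f ⊗ g) ⊗ g′ ⊖ (g ⊗ f) ⊗ g′) ⊕ (g ⊗ (f ⊗ g′) ⊖ g ⊗ (g′ ⊗ f))
        ≈⟨ ⊕-cong (⊖-cong (⊗-assoc f g g′) ≃-refl) (⊖-cong (≃-sym (⊗-assoc g f g′)) (≃-sym (⊗-assoc g g′ f))) ⟩
      (f ⊗ (g ⊗ g′) ⊖ (g ⊗ f) ⊗ g′) ⊕ ((g ⊗ f) ⊗ g′ ⊖ (g ⊗ g′) ⊗ f)
        ≈⟨ ⊖-telescope (f ⊗ (g ⊗ g′)) ((g ⊗ g′) ⊗ f) ((g ⊗ f) ⊗ g′) ⟩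
      ⟦ f , g ⊗ g′ ⟧ ∎)

  comm-cstˡ : ∀ a g → ⟦ cst a , g ⟧ ≃ cst 0#
  comm-cstˡ a g = ⊖-zero (cst-central a g)

  comm-cstʳ : ∀ f a → ⟦ f , cst a ⟧ ≃ cst 0#
  comm-cstʳ f a = ⊖-zero (≃-sym (cst-central a f))

  comm-self : ∀ f → ⟦ f , f ⟧ ≃ cst 0#
  comm-self f = ⊖-zero ≃-refl

  comm-antisym : ∀ f g → ⟦ f , g ⟧ ≃ neg ⟦ g , f ⟧
  comm-antisym f g = ⊖-flip (f ⊗ g) (g ⊗ f)

  -- Every rewriting rule of F-PC is a non-commutative identity, except for
  -- commutativity of products, which swaps the factors.
  data Elementary : Fm → Fm → Set where
    identity : ∀ {f g} → f ≃ g → Elementary f g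
    swap     : ∀ f g → Elementary (f ⊗ g) (g ⊗ f)

  elementary-sym : ∀ {f g} → Elementary f g → Elementary g f
  elementary-sym (identity p) = identity (≃-sym p)
  elementary-sym (swap f g)   = swap g f

  rule-elementary : ∀ {f g} → Rule 𝔽 f g → Elementary f g
  rule-elementary (zero-mul f)      = identity (⊗-zeroˡ f)
  rule-elementary (one-mul f)       = identity (⊗-identityˡ f)
  rule-elementary (const t α e β≈α) =
    identity (≃-trans (closed-value t e) (coeffwise λ { [] → β≈α ; (_ ∷ _) → R.refl }))
  rule-elementary (+-comm f g)      = identity (⊕-comm f g)
  rule-elementary (*-comm f g)      = swap f g
  rule-elementary (+-assoc f g h)   = identity (≃-sym (⊕-assoc f g h))
  rule-elementary (*-assoc f g h)   = identity (≃-sym (⊗-assoc f g h))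
  rule-elementary (distrib f g h)   = identity (⊗-distribˡ f g h)

size-pos : ∀ {A V} (f : Form A V) → 1 ≤ size f
size-pos (var _) = s≤s z≤n
size-pos (cst _) = s≤s z≤n
size-pos (_ ⊕ _) = s≤s z≤n
size-pos (_ ⊗ _) = s≤s z≤n

module Certificates (𝔽 : Field) {n m : ℕ} (fs : Vec (F 𝔽 (Fin n)) m) where
  open Polynomials 𝔽 {n}
  open Field 𝔽 using (0#; 1#; -_)
  open SizeArithmetic
  open ℕₚ.≤-Reasoning

  -- formulas in the variables x and the placeholders y_a, one per axiom a
  IPS : Set
  IPS = F 𝔽 (Fin n ⊎ Ax 𝔽 n m)

  lift : Fm → IPS
  lift = subst (λ i → var (inj₁ i))

  atZero : IPS → Fm
  atZero = plugY 𝔽 (λ _ → cst 0#)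

  atAxioms : IPS → Fm
  atAxioms = plugY 𝔽 (axioms 𝔽 fs)

  plug-lift : ∀ σ f → plugY 𝔽 σ (lift f) ≡ f
  plug-lift σ (var _) = refl
  plug-lift σ (cst _) = refl
  plug-lift σ (f ⊕ g) = ≡.cong₂ _⊕_ (plug-lift σ f) (plug-lift σ g)
  plug-lift σ (f ⊗ g) = ≡.cong₂ _⊗_ (plug-lift σ f) (plug-lift σ g)

  infix 4 _⊩_
  record _⊩_ (X : IPS) (Δ : Fm) : Set where
    constructor certifies
    field
      vanishes : atZero X ≃ cst 0#
      derives  : atAxioms X ≃ Δ
  open _⊩_ public

  axiom-⊩ : ∀ a → var (inj₂ a) ⊩ axioms 𝔽 fs a
  axiom-⊩ a = certifies ≃-refl ≃-refl

  zero-⊩ : cst 0# ⊩ cst 0#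
  zero-⊩ = certifies ≃-refl ≃-refl

  ⊩-resp : ∀ {X Δ Δ′} → X ⊩ Δ → Δ ≃ Δ′ → X ⊩ Δ′
  ⊩-resp (certifies v d) p = certifies v (≃-trans d p)

  ⊩-⊕ : ∀ {X Y Δ Δ′} → X ⊩ Δ → Y ⊩ Δ′ → X ⊕ Y ⊩ Δ ⊕ Δ′
  ⊩-⊕ (certifies v d) (certifies v′ d′) =
    certifies (≃-trans (⊕-cong v v′) (⊕-identityʳ (cst 0#))) (⊕-cong d d′)

  ⊩-⊗ˡ : ∀ f {X Δ} → X ⊩ Δ → lift f ⊗ X ⊩ f ⊗ Δ
  ⊩-⊗ˡ f (certifies v d) = certifies
    (≃-trans (⊗-cong (≡⇒≃ (plug-lift _ f)) v) (⊗-zeroʳ f))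
    (⊗-cong (≡⇒≃ (plug-lift _ f)) d)

  ⊩-⊗ʳ : ∀ f {X Δ} → X ⊩ Δ → X ⊗ lift f ⊩ Δ ⊗ f
  ⊩-⊗ʳ f (certifies v d) = certifies
    (≃-trans (⊗-cong v (≡⇒≃ (plug-lift _ f))) (⊗-zeroˡ f))
    (⊗-cong d (≡⇒≃ (plug-lift _ f)))

  commAxiom : ∀ {i j : Fin n} → i Fin.< j → IPS
  commAxiom {i} {j} i<j = var (inj₂ (inj₂ (inj₂ ((i , j) , i<j))))

  -- Certificates of commutators: ⟦ x_i , g ⟧ by the Leibniz rule in g down to
  -- pairs of variables, which are commutator axioms (up to sign), and
  -- ⟦ f , g ⟧ by the Leibniz rule in f down to variables.
  commVarCert : Fin n → Fm → IPS
  commVarCert i (var j) with Finₚ.<-cmp i j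
  ... | tri< i<j _ _ = commAxiom i<j
  ... | tri≈ _ _ _   = cst 0#
  ... | tri> _ _ j<i = cst (- 1#) ⊗ commAxiom j<i
  commVarCert i (cst _)  = cst 0#
  commVarCert i (g ⊕ g′) = commVarCert i g ⊕ commVarCert i g′
  commVarCert i (g ⊗ g′) = commVarCert i g ⊗ lift g′ ⊕ lift g ⊗ commVarCert i g′

  commCert : Fm → Fm → IPS
  commCert (var i)  g = commVarCert i g
  commCert (cst _)  g = cst 0#
  commCert (f ⊕ f′) g = commCert f g ⊕ commCert f′ g
  commCert (f ⊗ f′) g = lift f ⊗ commCert f′ g ⊕ commCert f g ⊗ lift f′

  commVarCert-⊩ : ∀ i g → commVarCert i g ⊩ ⟦ var i , g ⟧
  commVarCert-⊩ i (var j) with Finₚ.<-cmp i j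
  ... | tri< i<j _ _  = axiom-⊩ (inj₂ (inj₂ ((i , j) , i<j)))
  ... | tri≈ _ refl _ = ⊩-resp zero-⊩ (≃-sym (comm-self (var i)))
  ... | tri> _ _ j<i  =
    ⊩-resp (⊩-⊗ˡ (cst (- 1#)) (axiom-⊩ (inj₂ (inj₂ ((j , i) , j<i))))) (≃-sym (comm-antisym (var i) (var j)))
  commVarCert-⊩ i (cst a)  = ⊩-resp zero-⊩ (≃-sym (comm-cstʳ (var i) a))
  commVarCert-⊩ i (g ⊕ g′) =
    ⊩-resp (⊩-⊕ (commVarCert-⊩ i g) (commVarCert-⊩ i g′)) (≃-sym (comm-⊕ʳ (var i) g g′))
  commVarCert-⊩ i (g ⊗ g′) =
    ⊩-resp (⊩-⊕ (⊩-⊗ʳ g′ (commVarCert-⊩ i g)) (⊩-⊗ˡ g (commVarCert-⊩ i g′))) (≃-sym (comm-⊗ʳ (var i) g g′))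

  commCert-⊩ : ∀ f g → commCert f g ⊩ ⟦ f , g ⟧
  commCert-⊩ (var i)  g = commVarCert-⊩ i g
  commCert-⊩ (cst a)  g = ⊩-resp zero-⊩ (≃-sym (comm-cstˡ a g))
  commCert-⊩ (f ⊕ f′) g =
    ⊩-resp (⊩-⊕ (commCert-⊩ f g) (commCert-⊩ f′ g)) (≃-sym (comm-⊕ˡ f f′ g))
  commCert-⊩ (f ⊗ f′) g =
    ⊩-resp (⊩-⊕ (⊩-⊗ˡ f (commCert-⊩ f′ g)) (⊩-⊗ʳ f′ (commCert-⊩ f g))) (≃-sym (comm-⊗ˡ f f′ g))

  elementaryCert : ∀ {f g} → Elementary f g → IPS
  elementaryCert (identity _) = cst 0#
  elementaryCert (swap f g)   = commCert g f

  elementaryCert-⊩ : ∀ {f g} (e : Elementary f g) → elementaryCert e ⊩ g ⊖ f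
  elementaryCert-⊩ (identity f≃g) = ⊩-resp zero-⊩ (≃-sym (⊖-zero (≃-sym f≃g)))
  elementaryCert-⊩ (swap f g)     = commCert-⊩ g f

  rewriteCert : ∀ {f g} → Rewrite 𝔽 f g → IPS
  rewriteCert (fwd r)   = elementaryCert (rule-elementary r)
  rewriteCert (bwd r)   = elementaryCert (elementary-sym (rule-elementary r))
  rewriteCert (⊕ˡ _ r)  = rewriteCert r
  rewriteCert (⊕ʳ _ r)  = rewriteCert r
  rewriteCert (⊗ˡ g r)  = rewriteCert r ⊗ lift g
  rewriteCert (⊗ʳ f r)  = lift f ⊗ rewriteCert r

  rewriteCert-⊩ : ∀ {f g} (r : Rewrite 𝔽 f g) → rewriteCert r ⊩ g ⊖ f
  rewriteCert-⊩ (fwd r)            = elementaryCert-⊩ (rule-elementary r)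
  rewriteCert-⊩ (bwd r)            = elementaryCert-⊩ (elementary-sym (rule-elementary r))
  rewriteCert-⊩ (⊕ˡ {f} {f′} g r)  = ⊩-resp (rewriteCert-⊩ r) (≃-sym (⊖-cancelʳ f′ f g))
  rewriteCert-⊩ (⊕ʳ f {g} {g′} r)  = ⊩-resp (rewriteCert-⊩ r) (≃-sym (⊖-cancelˡ g′ g f))
  rewriteCert-⊩ (⊗ˡ {f} {f′} g r)  = ⊩-resp (⊩-⊗ʳ g (rewriteCert-⊩ r)) (⊗-⊖-distribʳ f′ f g)
  rewriteCert-⊩ (⊗ʳ f {g} {g′} r)  = ⊩-resp (⊩-⊗ˡ f (rewriteCert-⊩ r)) (⊗-⊖-distribˡ g′ g f)

  size-lift : ∀ f → size (lift f) ≡ size f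
  size-lift (var _) = refl
  size-lift (cst _) = refl
  size-lift (f ⊕ g) = ≡.cong₂ (λ a b → suc (a ℕ.+ b)) (size-lift f) (size-lift g)
  size-lift (f ⊗ g) = ≡.cong₂ (λ a b → suc (a ℕ.+ b)) (size-lift f) (size-lift g)

  commVarCert-size : ∀ i g → size (commVarCert i g) ≤ 3 ℕ.* sq (size g)
  commVarCert-size i (var j) with Finₚ.<-cmp i j
  ... | tri< _ _ _ = s≤s z≤n
  ... | tri≈ _ _ _ = s≤s z≤n
  ... | tri> _ _ _ = ℕₚ.≤-refl
  commVarCert-size i (cst _) = s≤s z≤n
  commVarCert-size i (g ⊕ g′) = ℕₚ.≤-trans (⊕-node (size g) (size g′) _ _)
    (quadratic-growth (size g) (size g′) ℕₚ.≤-refl (commVarCert-size i g) (commVarCert-size i g′))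
  commVarCert-size i (g ⊗ g′) = begin
    suc (suc (x ℕ.+ size (lift g′)) ℕ.+ suc (size (lift g) ℕ.+ y))
      ≡⟨ ≡.cong₂ (λ b a → suc (suc (x ℕ.+ b) ℕ.+ suc (a ℕ.+ y))) (size-lift g′) (size-lift g) ⟩
    suc (suc (x ℕ.+ size g′) ℕ.+ suc (size g ℕ.+ y))   ≡⟨ ⊗-nodeʳ (size g) (size g′) x y ⟩
    3 ℕ.+ size g ℕ.+ size g′ ℕ.+ x ℕ.+ y
      ≤⟨ quadratic-growth (size g) (size g′) ℕₚ.≤-refl (commVarCert-size i g) (commVarCert-size i g′) ⟩
    3 ℕ.* sq (size (g ⊗ g′))                             ∎
    where
    x = size (commVarCert i g)
    y = size (commVarCert i g′)

  commCert-size : ∀ f g → size (commCert f g) ≤ 3 ℕ.* sq (size g) ℕ.* sq (size f)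
  commCert-size (var i) g =
    ℕₚ.≤-trans (commVarCert-size i g) (ℕₚ.≤-reflexive (≡.sym (ℕₚ.*-identityʳ _)))
  commCert-size (cst _) g =
    ℕₚ.≤-trans (ℕₚ.≤-trans (s≤s z≤n) (three≤ (size-pos g))) (ℕₚ.≤-reflexive (≡.sym (ℕₚ.*-identityʳ _)))
  commCert-size (f ⊕ f′) g = ℕₚ.≤-trans (⊕-node (size f) (size f′) _ _)
    (quadratic-growth (size f) (size f′) (three≤ (size-pos g)) (commCert-size f g) (commCert-size f′ g))
  commCert-size (f ⊗ f′) g = begin
    suc (suc (size (lift f) ℕ.+ y) ℕ.+ suc (x ℕ.+ size (lift f′)))
      ≡⟨ ≡.cong₂ (λ a b → suc (suc (a ℕ.+ y) ℕ.+ suc (x ℕ.+ b))) (size-lift f) (size-lift f′) ⟩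
    suc (suc (size f ℕ.+ y) ℕ.+ suc (x ℕ.+ size f′))   ≡⟨ ⊗-nodeˡ (size f) (size f′) x y ⟩
    3 ℕ.+ size f ℕ.+ size f′ ℕ.+ x ℕ.+ y
      ≤⟨ quadratic-growth (size f) (size f′) (three≤ (size-pos g)) (commCert-size f g) (commCert-size f′ g) ⟩
    3 ℕ.* sq (size g) ℕ.* sq (size (f ⊗ f′))             ∎
    where
    x = size (commCert f g)
    y = size (commCert f′ g)

  elementaryCert-size : ∀ {f g} (e : Elementary f g) → size (elementaryCert e) ≤ quartic (size f)
  elementaryCert-size {f} (identity _) = 1≤quartic (size-pos f)
  elementaryCert-size (swap f g) = ℕₚ.≤-trans (commCert-size g f)
    (ℕₚ.*-mono-≤ (ℕₚ.*-monoʳ-≤ 3 (sq-mono f≤)) (sq-mono g≤))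
    where
    f≤ : size f ≤ size (f ⊗ g)
    f≤ = ℕₚ.≤-trans (ℕₚ.m≤m+n (size f) (size g)) (ℕₚ.n≤1+n _)
    g≤ : size g ≤ size (f ⊗ g)
    g≤ = ℕₚ.≤-trans (ℕₚ.m≤n+m (size g) (size f)) (ℕₚ.n≤1+n _)

  rewriteCert-size : ∀ {f g} (r : Rewrite 𝔽 f g) → size (rewriteCert r) ≤ rewriteBound (size f)
  rewriteCert-size {f} (fwd r) =
    ℕₚ.≤-trans (elementaryCert-size (rule-elementary r)) (ℕₚ.m≤n+m _ (size f))
  rewriteCert-size {f} (bwd r) =
    ℕₚ.≤-trans (elementaryCert-size (elementary-sym (rule-elementary r))) (ℕₚ.m≤n+m _ (size f))
  rewriteCert-size (⊕ˡ {f} g r) = ℕₚ.≤-trans (rewriteCert-size r)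
    (rewriteBound-mono (ℕₚ.≤-trans (ℕₚ.m≤m+n (size f) (size g)) (ℕₚ.n≤1+n _)))
  rewriteCert-size (⊕ʳ f {g} r) = ℕₚ.≤-trans (rewriteCert-size r)
    (rewriteBound-mono (ℕₚ.≤-trans (ℕₚ.m≤n+m (size g) (size f)) (ℕₚ.n≤1+n _)))
  rewriteCert-size (⊗ˡ {f} g r) =
    ℕₚ.≤-trans (ℕₚ.≤-reflexive (≡.cong (λ b → suc (size (rewriteCert r) ℕ.+ b)) (size-lift g)))
               (rewriteBound-⊗ˡ (size f) (size g) (rewriteCert-size r))
  rewriteCert-size (⊗ʳ f {g} r) =
    ℕₚ.≤-trans (ℕₚ.≤-reflexive (≡.cong (λ a → suc (a ℕ.+ size (rewriteCert r))) (size-lift f)))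
               (rewriteBound-⊗ʳ (size f) (size g) (rewriteCert-size r))

module Bookkeeping where
  open import Data.Nat using (zero; _+_; _≟_)
  open import Data.List.Relation.Unary.All using (All; []; _∷_)
  open import Relation.Nullary using (¬_; Dec; yes; no)
  open import Relation.Binary.PropositionalEquality using (_≢_)
  open import Data.Empty using (⊥-elim)
  open import Data.Nat.ListAction using (sum)
  open import Data.Nat.Tactic.RingSolver using (solve-∀)
  open import Function using (_∘_)
  open ℕₚ.≤-Reasoning

  uses : ℕ → List ℕ → ℕ
  uses j L = List.length (List.filter (_≟ j) L)

  uses-++ : ∀ j L L′ → uses j (L List.++ L′) ≡ uses j L + uses j L′
  uses-++ j L L′ = ≡.trans (≡.cong List.length (Listₚ.filter-++ (_≟ j) L L′))
                           (Listₚ.length-++ (List.filter (_≟ j) L))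

  uses-here : ∀ j L → uses j (j ∷ L) ≡ suc (uses j L)
  uses-here j L = ≡.cong List.length (Listₚ.filter-accept (_≟ j) refl)

  uses-there : ∀ {x} j L → x ≢ j → uses j (x ∷ L) ≡ uses j L
  uses-there j L x≢j = ≡.cong List.length (Listₚ.filter-reject (_≟ j) x≢j)

  uses-∷ : ∀ x j L → uses j L ≤ uses j (x ∷ L)
  uses-∷ x j L with x ≟ j
  ... | yes refl = ℕₚ.≤-trans (ℕₚ.n≤1+n _) (ℕₚ.≤-reflexive (≡.sym (uses-here j L)))
  ... | no x≢j   = ℕₚ.≤-reflexive (≡.sym (uses-there j L x≢j))

  uses-beyond : ∀ {k j L} → All (_< k) L → k ≤ j → uses j L ≡ 0
  uses-beyond []                    k≤j = refl
  uses-beyond {L = x ∷ L} (x<k ∷ p) k≤j =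
    ≡.trans (uses-there _ L (λ x≡j → ℕₚ.<-irrefl x≡j (ℕₚ.<-≤-trans x<k k≤j))) (uses-beyond p k≤j)

  update : {A : Set} → ℕ → A → (ℕ → A) → ℕ → A
  update k v f j with j ≟ k
  ... | yes _ = v
  ... | no  _ = f j

  update-≡ : {A : Set} (k : ℕ) (v : A) (f : ℕ → A) → update k v f k ≡ v
  update-≡ k v f with k ≟ k
  ... | yes _  = refl
  ... | no k≢k = ⊥-elim (k≢k refl)

  update-≢ : {A : Set} {k j : ℕ} (v : A) (f : ℕ → A) → j ≢ k → update k v f j ≡ f j
  update-≢ {k = k} {j} v f j≢k with j ≟ k
  ... | yes j≡k = ⊥-elim (j≢k j≡k)
  ... | no  _   = refl

  total : ℕ → (ℕ → ℕ) → ℕ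
  total zero    w = 0
  total (suc k) w = total k w + w k

  total-cong : ∀ k {w w′} → (∀ j → j < k → w j ≡ w′ j) → total k w ≡ total k w′
  total-cong zero    _ = refl
  total-cong (suc k) e = ≡.cong₂ _+_ (total-cong k (λ j j<k → e j (ℕₚ.m<n⇒m<1+n j<k))) (e k ℕₚ.≤-refl)

  total-update-beyond : ∀ k {j} v w → k ≤ j → total k (update j v w) ≡ total k w
  total-update-beyond k v w k≤j =
    total-cong k (λ i i<k → update-≢ v w (λ i≡j → ℕₚ.<-irrefl i≡j (ℕₚ.<-≤-trans i<k k≤j)))

  total-update : ∀ k {i} w → i < k → total k (update i 0 w) + w i ≡ total k w
  total-update (suc k) {i} w i<1+k with i ≟ k
  ... | yes refl = begin-equality
    total k (update i 0 w) + update i 0 w i + w i  ≡⟨ ≡.cong (λ z → total k (update i 0 w) + z + w i) (update-≡ i 0 w) ⟩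
    total k (update i 0 w) + 0 + w i               ≡⟨ ≡.cong (λ z → z + w i) (ℕₚ.+-identityʳ _) ⟩
    total k (update i 0 w) + w i                   ≡⟨ ≡.cong (_+ w i) (total-update-beyond k 0 w ℕₚ.≤-refl) ⟩
    total k w + w i                                ∎
  ... | no i≢k = begin-equality
    total k (update i 0 w) + update i 0 w k + w i  ≡⟨ ≡.cong (λ z → total k (update i 0 w) + z + w i) (update-≢ 0 w (i≢k ∘ ≡.sym)) ⟩
    total k (update i 0 w) + w k + w i             ≡⟨ ℕₚ.+-assoc _ (w k) (w i) ⟩
    total k (update i 0 w) + (w k + w i)           ≡⟨ ≡.cong (total k (update i 0 w) +_) (ℕₚ.+-comm (w k) (w i)) ⟩
    total k (update i 0 w) + (w i + w k)           ≡⟨ ℕₚ.+-assoc _ (w i) (w k) ⟨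
    total k (update i 0 w) + w i + w k             ≡⟨ ≡.cong (_+ w k) (total-update k w (ℕₚ.≤∧≢⇒< (ℕₚ.≤-pred i<1+k) i≢k)) ⟩
    total k w + w k                                ∎

  discharge : List ℕ → (ℕ → ℕ) → ℕ → ℕ
  discharge []      w = w
  discharge (i ∷ L) w = discharge L (update i 0 w)

  discharge-unused : ∀ L w j → uses j L ≡ 0 → discharge L w j ≡ w j
  discharge-unused []      w j _ = refl
  discharge-unused (i ∷ L) w j unused with i ≟ j
  ... | yes refl = ⊥-elim (ℕₚ.0≢1+n (≡.trans (≡.sym unused) (uses-here j L)))
  ... | no  i≢j  = ≡.trans (discharge-unused L (update i 0 w) j (≡.trans (≡.sym (uses-there j L i≢j)) unused))
                           (update-≢ 0 w (i≢j ∘ ≡.sym))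

  private
    used-once : ∀ a b → a + suc b ≤ 1 → a ≡ 0 × b ≡ 0
    used-once zero    zero    _       = refl , refl
    used-once zero    (suc b) (s≤s ())
    used-once (suc a) b       (s≤s p) with ℕₚ.≤-trans (ℕₚ.m≤n+m (suc b) a) p
    ... | ()

    +-shift : ∀ t l v → (t + l) + (v + 1) ≡ (t + v) + suc l
    +-shift = solve-∀

  -- Lines satisfying D (the derived
  -- lines) may be used at most once in the whole proof and are paid for by
  -- their weight; the other lines cost at most 1.  Discharging L frees
  -- enough weight to pay for the costs of L, up to one unit per premise.
  module Spending (k : ℕ) (cost prior : ℕ → ℕ) {D : ℕ → Set} (D? : ∀ j → Dec (D j))
                  (cheap : ∀ j → j < k → ¬ D j → cost j ≤ 1) where

    UsedOnce : List ℕ → Set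
    UsedOnce L = ∀ j → D j → prior j + uses j L ≤ 1

    Paid : List ℕ → (ℕ → ℕ) → Set
    Paid L w = ∀ j → D j → prior j ≡ 0 → 1 ≤ uses j L → cost j ≤ w j

    spend : ∀ L w → All (_< k) L → UsedOnce L → Paid L w →
            total k (discharge L w) + sum (List.map cost L) ≤ total k w + List.length L
    spend []      w []             _    _    = ℕₚ.≤-refl
    spend (i ∷ L) w (i<k ∷ bounded) once paid = begin
      total k (discharge L w′) + (cost i + sum (List.map cost L))
        ≡⟨ SizeArithmetic.+-rotate (total k (discharge L w′)) (cost i) (sum (List.map cost L)) ⟩
      (total k (discharge L w′) + sum (List.map cost L)) + cost i
        ≤⟨ ℕₚ.+-mono-≤ (spend L w′ bounded once′ paid′) first ⟩
      (total k w′ + List.length L) + (w i + 1)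
        ≡⟨ +-shift (total k w′) (List.length L) (w i) ⟩
      (total k w′ + w i) + suc (List.length L)
        ≡⟨ ≡.cong (_+ suc (List.length L)) (total-update k w i<k) ⟩
      total k w + suc (List.length L) ∎
      where
      w′ = update i 0 w

      once-here : D i → prior i + suc (uses i L) ≤ 1
      once-here d = ℕₚ.≤-trans (ℕₚ.≤-reflexive (≡.cong (prior i +_) (≡.sym (uses-here i L)))) (once i d)

      -- the first premise is paid for by its weight, or is an axiom line
      first : cost i ≤ w i + 1
      first with D? i
      ... | yes d = ℕₚ.≤-trans (paid i d (proj₁ (used-once _ _ (once-here d))) used-here) (ℕₚ.m≤m+n _ 1)
        where used-here = ℕₚ.≤-trans (s≤s z≤n) (ℕₚ.≤-reflexive (≡.sym (uses-here i L)))
      ... | no ¬d = ℕₚ.≤-trans (cheap i i<k ¬d) (ℕₚ.m≤n+m 1 (w i))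

      once′ : UsedOnce L
      once′ j d = ℕₚ.≤-trans (ℕₚ.+-monoʳ-≤ (prior j) (uses-∷ i j L)) (once j d)

      -- a derived line occurring again in L is not i, since i is used once
      paid′ : Paid L w′
      paid′ j d unused used with i ≟ j
      ... | yes refl with () ← ℕₚ.≤-trans used (ℕₚ.≤-reflexive (proj₂ (used-once _ _ (once-here d))))
      ... | no  i≢j  = ℕₚ.≤-trans (paid j d unused (ℕₚ.≤-trans used (uses-∷ i j L)))
                                 (ℕₚ.≤-reflexive (≡.sym (update-≢ 0 w (i≢j ∘ ≡.sym))))

module ProofStructure (𝔽 : Field) {n m : ℕ} (fs : Vec (F 𝔽 (Fin n)) m) where
  open import Data.List.Relation.Unary.All as All using (All; []; _∷_)
  import Data.List.Relation.Unary.All.Properties as Allₚ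
  open import Relation.Nullary using (Dec; yes; no)
  open import Data.Empty using (⊥-elim)
  open import Data.Unit using (tt)
  open Bookkeeping using (uses; uses-++; uses-beyond)

  private
    Fm = F 𝔽 (Fin n)

  premisesJ-earlier : ∀ {k} {prev : Vec Fm k} {Φ} (J : Just 𝔽 fs prev Φ) → All (_< k) (premisesJ 𝔽 fs J)
  premisesJ-earlier (hyp _)        = []
  premisesJ-earlier (bool _)       = []
  premisesJ-earlier (prod i _)     = Finₚ.toℕ<n i ∷ []
  premisesJ-earlier (add i i′ _ _) = Finₚ.toℕ<n i ∷ Finₚ.toℕ<n i′ ∷ []
  premisesJ-earlier (rw i _)       = Finₚ.toℕ<n i ∷ []

  premisesJ-length : ∀ {k} {prev : Vec Fm k} {Φ} (J : Just 𝔽 fs prev Φ) → List.length (premisesJ 𝔽 fs J) ≤ 2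
  premisesJ-length (hyp _)        = z≤n
  premisesJ-length (bool _)       = z≤n
  premisesJ-length (prod _ _)     = s≤s z≤n
  premisesJ-length (add _ _ _ _)  = ℕₚ.≤-refl
  premisesJ-length (rw _ _)       = s≤s z≤n

  premises-earlier : ∀ {k} {ls : Vec Fm k} (P : Proof 𝔽 fs ls) → All (_< k) (premises 𝔽 fs P)
  premises-earlier []      = []
  premises-earlier (P ▷ J) =
    Allₚ.++⁺ (All.map ℕₚ.m<n⇒m<1+n (premises-earlier P)) (All.map ℕₚ.m<n⇒m<1+n (premisesJ-earlier J))

  isDerived? : ∀ {k} {prev : Vec Fm k} {Φ} (J : Just 𝔽 fs prev Φ) → Dec (isDerived 𝔽 fs J)
  isDerived? (hyp _)       = no λ ()
  isDerived? (bool _)      = no λ ()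
  isDerived? (prod _ _)    = yes tt
  isDerived? (add _ _ _ _) = yes tt
  isDerived? (rw _ _)      = yes tt

  derived? : ∀ {k} {ls : Vec Fm k} (P : Proof 𝔽 fs ls) j → Dec (Derived 𝔽 fs P j)
  derived? []              j = no λ ()
  derived? (_▷_ {k} P J) j with j ℕ.≟ k
  ... | yes _ = isDerived? J
  ... | no  _ = derived? P j

  derived-earlier : ∀ {k} {ls : Vec Fm k} (P : Proof 𝔽 fs ls) j → Derived 𝔽 fs P j → j < k
  derived-earlier (_▷_ {k} P J) j d with j ℕ.≟ k
  ... | yes refl = ℕₚ.≤-refl
  ... | no  _    = ℕₚ.m<n⇒m<1+n (derived-earlier P j d)

  derived-▷ : ∀ {k} {prev : Vec Fm k} {Φ} (P : Proof 𝔽 fs prev) (J : Just 𝔽 fs prev Φ) j →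
              j < k → Derived 𝔽 fs P j → Derived 𝔽 fs (P ▷ J) j
  derived-▷ {k} P J j j<k d with j ℕ.≟ k
  ... | yes j≡k = ⊥-elim (ℕₚ.<-irrefl j≡k j<k)
  ... | no  _   = d

  treeLike-init : ∀ {k} {prev : Vec Fm k} {Φ} (P : Proof 𝔽 fs prev) (J : Just 𝔽 fs prev Φ) →
                  TreeLike 𝔽 fs (P ▷ J) → TreeLike 𝔽 fs P
  treeLike-init P J tl j d = ℕₚ.≤-trans (ℕₚ.m≤m+n _ (uses j (premisesJ 𝔽 fs J)))
    (ℕₚ.≤-trans (ℕₚ.≤-reflexive (≡.sym (uses-++ j (premises 𝔽 fs P) (premisesJ 𝔽 fs J))))
                (tl j (derived-▷ P J j (derived-earlier P j d) d)))

  proofSize-∷ʳ : ∀ {k} (ls : Vec Fm k) Φ → proofSize 𝔽 fs (ls Vec.∷ʳ Φ) ≡ proofSize 𝔽 fs ls ℕ.+ size Φ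
  proofSize-∷ʳ Vec.[]       Φ = ℕₚ.+-identityʳ (size Φ)
  proofSize-∷ʳ (f Vec.∷ ls) Φ =
    ≡.trans (≡.cong (size f ℕ.+_) (proofSize-∷ʳ ls Φ)) (≡.sym (ℕₚ.+-assoc (size f) _ _))

  proofSize-init : ∀ {k} (ls : Vec Fm k) Φ {S} → proofSize 𝔽 fs (ls Vec.∷ʳ Φ) ≤ S → proofSize 𝔽 fs ls ≤ S
  proofSize-init ls Φ ≤S =
    ℕₚ.≤-trans (ℕₚ.m≤m+n _ (size Φ)) (ℕₚ.≤-trans (ℕₚ.≤-reflexive (≡.sym (proofSize-∷ʳ ls Φ))) ≤S)

  lookup-size : ∀ {k} (ls : Vec Fm k) i → size (Vec.lookup ls i) ≤ proofSize 𝔽 fs ls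
  lookup-size (f Vec.∷ ls) Fin.zero    = ℕₚ.m≤m+n _ _
  lookup-size (f Vec.∷ ls) (Fin.suc i) = ℕₚ.≤-trans (lookup-size ls i) (ℕₚ.m≤n+m _ (size f))

  length≤proofSize : ∀ {k} (ls : Vec Fm k) → k ≤ proofSize 𝔽 fs ls
  length≤proofSize Vec.[]       = z≤n
  length≤proofSize (f Vec.∷ ls) = ℕₚ.+-mono-≤ (size-pos f) (length≤proofSize ls)

  last-unused : ∀ {k} {prev : Vec Fm k} {Φ} (P : Proof 𝔽 fs prev) (J : Just 𝔽 fs prev Φ) →
                uses k (premises 𝔽 fs (P ▷ J)) ≡ 0
  last-unused P J = uses-beyond (Allₚ.++⁺ (premises-earlier P) (premisesJ-earlier J)) ℕₚ.≤-refl

  lookup-∷ʳ : ∀ {k} (ls : Vec Fm k) Φ (i : Fin (suc k)) →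
    (toℕ i ≡ k × Vec.lookup (ls Vec.∷ʳ Φ) i ≡ Φ) ⊎
    Σ (Fin k) λ j → toℕ i ≡ toℕ j × Vec.lookup (ls Vec.∷ʳ Φ) i ≡ Vec.lookup ls j
  lookup-∷ʳ Vec.[]       Φ Fin.zero    = inj₁ (refl , refl)
  lookup-∷ʳ (f Vec.∷ ls) Φ Fin.zero    = inj₂ (Fin.zero , refl , refl)
  lookup-∷ʳ (f Vec.∷ ls) Φ (Fin.suc i) with lookup-∷ʳ ls Φ i
  ... | inj₁ (e , l)     = inj₁ (≡.cong suc e , l)
  ... | inj₂ (j , e , l) = inj₂ (Fin.suc j , ≡.cong suc e , l)

module LineCertificates (𝔽 : Field) {n m : ℕ} (fs : Vec (F 𝔽 (Fin n)) m) where
  open import Data.Nat.ListAction using (sum)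
  open import Relation.Nullary using (¬_; yes; no)
  open import Data.Empty using (⊥-elim)
  open Polynomials 𝔽 {n}
  open Certificates 𝔽 fs
  open ProofStructure 𝔽 fs
  open Bookkeeping
  open SizeArithmetic
  open Field 𝔽 using (0#; 1#)
  open ℕₚ.≤-Reasoning

  lineCert : ∀ {k} {prev : Vec Fm k} {Φ} → (ℕ → IPS) → Just 𝔽 fs prev Φ → IPS
  lineCert C (hyp j)        = var (inj₂ (inj₁ j))
  lineCert C (bool r)       = var (inj₂ (inj₂ (inj₁ r)))
  lineCert C (prod i r)     = var (inj₁ r) ⊗ C (toℕ i)
  lineCert C (add i i′ a b) = cst a ⊗ C (toℕ i) ⊕ cst b ⊗ C (toℕ i′)
  lineCert C (rw i r)       = C (toℕ i) ⊕ rewriteCert r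

  certs : ∀ {k} {ls : Vec Fm k} → Proof 𝔽 fs ls → ℕ → IPS
  certs []            = λ _ → cst 0#
  certs (_▷_ {k} P J) = update k (lineCert (certs P) J) (certs P)

  lineCert-⊩ : ∀ {k} {prev : Vec Fm k} {Φ} (C : ℕ → IPS) →
               (∀ i → C (toℕ i) ⊩ Vec.lookup prev i) → (J : Just 𝔽 fs prev Φ) → lineCert C J ⊩ Φ
  lineCert-⊩ C ok (hyp j)        = axiom-⊩ (inj₁ j)
  lineCert-⊩ C ok (bool r)       = axiom-⊩ (inj₂ (inj₁ r))
  lineCert-⊩ C ok (prod i r)     = ⊩-⊗ˡ (var r) (ok i)
  lineCert-⊩ C ok (add i i′ a b) = ⊩-⊕ (⊩-⊗ˡ (cst a) (ok i)) (⊩-⊗ˡ (cst b) (ok i′))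
  lineCert-⊩ C ok (rw i r)       = ⊩-resp (⊩-⊕ (ok i) (rewriteCert-⊩ r)) (⊕-⊖-cancel _ _)

  certs-⊩ : ∀ {k} {ls : Vec Fm k} (P : Proof 𝔽 fs ls) (i : Fin k) → certs P (toℕ i) ⊩ Vec.lookup ls i
  certs-⊩ (_▷_ {k} {prev} {Φ} P J) i with lookup-∷ʳ prev Φ i
  ... | inj₁ (i≡k , line) =
    ≡.subst₂ _⊩_ (≡.sym (≡.trans (≡.cong (update k _ (certs P)) i≡k) (update-≡ k _ (certs P))))
                 (≡.sym line) (lineCert-⊩ (certs P) (certs-⊩ P) J)
  ... | inj₂ (j , i≡j , line) =
    ≡.subst₂ _⊩_ (≡.sym (≡.trans (≡.cong (update k _ (certs P)) i≡j)
                                 (update-≢ _ (certs P) (λ j≡k → ℕₚ.<-irrefl j≡k (Finₚ.toℕ<n j)))))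
                 (≡.sym line) (certs-⊩ P j)

  axiomLine-size : ∀ {k} {ls : Vec Fm k} (P : Proof 𝔽 fs ls) j → j < k →
                   ¬ Derived 𝔽 fs P j → size (certs P j) ≤ 1
  axiomLine-size (_▷_ {k} P J) j j<1+k ¬d with j ℕ.≟ k
  axiomLine-size (P ▷ hyp _)       j _ _  | yes _ = ℕₚ.≤-refl
  axiomLine-size (P ▷ bool _)      j _ _  | yes _ = ℕₚ.≤-refl
  axiomLine-size (P ▷ prod _ _)    j _ ¬d | yes _ = ⊥-elim (¬d _)
  axiomLine-size (P ▷ add _ _ _ _) j _ ¬d | yes _ = ⊥-elim (¬d _)
  axiomLine-size (P ▷ rw _ _)      j _ ¬d | yes _ = ⊥-elim (¬d _)
  ... | no j≢k = axiomLine-size P j (ℕₚ.≤∧≢⇒< (ℕₚ.≤-pred j<1+k) j≢k) ¬d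

  lineCert-size : ∀ {k} {prev : Vec Fm k} {Φ} S (C : ℕ → IPS) (J : Just 𝔽 fs prev Φ) →
                  proofSize 𝔽 fs prev ≤ S →
                  size (lineCert C J) ≤ rewriteBound S ℕ.+ 5 ℕ.+ sum (List.map (λ j → size (C j)) (premisesJ 𝔽 fs J))
  lineCert-size S C (hyp _)        _ = axiom-overhead (rewriteBound S)
  lineCert-size S C (bool _)       _ = axiom-overhead (rewriteBound S)
  lineCert-size S C (prod i _)     _ = product-overhead (rewriteBound S) (size (C (toℕ i)))
  lineCert-size S C (add i i′ _ _) _ = sum-overhead (rewriteBound S) (size (C (toℕ i))) (size (C (toℕ i′)))
  lineCert-size {prev = prev} S C (rw i r) ≤S = rewrite-overhead (size (C (toℕ i)))
    (ℕₚ.≤-trans (rewriteCert-size r) (rewriteBound-mono (ℕₚ.≤-trans (lookup-size prev i) ≤S)))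

  -- Weights: a line is charged the size of its certificate until it is used
  -- as a premise, at which point its weight is discharged.
  weights : ∀ {k} {ls : Vec Fm k} → Proof 𝔽 fs ls → ℕ → ℕ
  weights []            = λ _ → 0
  weights (_▷_ {k} P J) = update k (size (lineCert (certs P) J)) (discharge (premisesJ 𝔽 fs J) (weights P))

  record Accounted {k} {ls : Vec Fm k} (P : Proof 𝔽 fs ls) (S : ℕ) : Set where
    field
      paid   : ∀ j → j < k → uses j (premises 𝔽 fs P) ≡ 0 → size (certs P j) ≤ weights P j
      budget : total k (weights P) ≤ k ℕ.* perLine S
  open Accounted

  paid-▷ : ∀ {k} {prev : Vec Fm k} {Φ} (P : Proof 𝔽 fs prev) (J : Just 𝔽 fs prev Φ) →
           (∀ j → j < k → uses j (premises 𝔽 fs P) ≡ 0 → size (certs P j) ≤ weights P j) →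
           ∀ j → j < suc k → uses j (premises 𝔽 fs (P ▷ J)) ≡ 0 → size (certs (P ▷ J) j) ≤ weights (P ▷ J) j
  paid-▷ {k} P J paid j j<1+k unused with j ℕ.≟ k
  ... | yes _  = ℕₚ.≤-refl
  ... | no j≢k = begin
    size (certs P j)            ≤⟨ paid j (ℕₚ.≤∧≢⇒< (ℕₚ.≤-pred j<1+k) j≢k) (ℕₚ.m+n≡0⇒m≡0 _ unused′) ⟩
    weights P j                 ≡⟨ discharge-unused L (weights P) j (ℕₚ.m+n≡0⇒n≡0 _ unused′) ⟨
    discharge L (weights P) j   ∎
    where
    L = premisesJ 𝔽 fs J
    unused′ = ≡.trans (≡.sym (uses-++ j (premises 𝔽 fs P) L)) unused

  -- adding a line costs at most perLine S: its overhead plus its premises,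
  -- which are paid for by discharging their weights (tree-likeness)
  budget-▷ : ∀ {k} {prev : Vec Fm k} {Φ} {S} (P : Proof 𝔽 fs prev) (J : Just 𝔽 fs prev Φ) →
             Accounted P S → TreeLike 𝔽 fs (P ▷ J) → proofSize 𝔽 fs prev ≤ S →
             total (suc k) (weights (P ▷ J)) ≤ suc k ℕ.* perLine S
  budget-▷ {k} {S = S} P J acc treeLike ≤S = begin
    total k (weights (P ▷ J)) ℕ.+ weights (P ▷ J) k
      ≡⟨ ≡.cong₂ ℕ._+_ (total-update-beyond k _ _ ℕₚ.≤-refl) (update-≡ k _ _) ⟩
    total k (discharge L (weights P)) ℕ.+ size (lineCert (certs P) J)
      ≤⟨ ℕₚ.+-monoʳ-≤ _ (lineCert-size S (certs P) J ≤S) ⟩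
    total k (discharge L (weights P)) ℕ.+ (rewriteBound S ℕ.+ 5 ℕ.+ sum (List.map cost L))
      ≡⟨ +-rotate (total k (discharge L (weights P))) (rewriteBound S ℕ.+ 5) (sum (List.map cost L)) ⟩
    total k (discharge L (weights P)) ℕ.+ sum (List.map cost L) ℕ.+ (rewriteBound S ℕ.+ 5)
      ≤⟨ ℕₚ.+-monoˡ-≤ _ (spend L (weights P) (premisesJ-earlier J) usedOnce paidPremises) ⟩
    total k (weights P) ℕ.+ List.length L ℕ.+ (rewriteBound S ℕ.+ 5)
      ≤⟨ ℕₚ.+-monoˡ-≤ _ (ℕₚ.+-mono-≤ (budget acc) (premisesJ-length J)) ⟩
    k ℕ.* perLine S ℕ.+ 2 ℕ.+ (rewriteBound S ℕ.+ 5)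
      ≡⟨ budget-step k (rewriteBound S) ⟩
    suc k ℕ.* perLine S ∎
    where
    L = premisesJ 𝔽 fs J
    cost = λ j → size (certs P j)
    open Spending k cost (λ j → uses j (premises 𝔽 fs P)) (derived? P) (axiomLine-size P)

    usedOnce : UsedOnce L
    usedOnce j d = ℕₚ.≤-trans (ℕₚ.≤-reflexive (≡.sym (uses-++ j (premises 𝔽 fs P) L)))
                              (treeLike j (derived-▷ P J j (derived-earlier P j d) d))

    paidPremises : Paid L (weights P)
    paidPremises j d unused _ = paid acc j (derived-earlier P j d) unused

  accounted : ∀ {k} {ls : Vec Fm k} (P : Proof 𝔽 fs ls) {S} →
              TreeLike 𝔽 fs P → proofSize 𝔽 fs ls ≤ S → Accounted P S
  accounted []                     _        _  = record { paid = λ _ () ; budget = z≤n }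
  accounted (_▷_ {prev = prev} {Φ} P J) treeLike ≤S = record
    { paid   = paid-▷ P J (paid acc)
    ; budget = budget-▷ P J acc treeLike ≤S′
    }
    where
    ≤S′ = proofSize-init prev Φ ≤S
    acc = accounted P (treeLike-init P J treeLike) ≤S′

  refutation : ∀ {k} {ls : Vec Fm (suc k)} (P : Proof 𝔽 fs ls) {S} → TreeLike 𝔽 fs P →
               Vec.last ls ≡ cst 1# → proofSize 𝔽 fs ls ≡ S →
               NCIPSRefutation 𝔽 fs (evalPoly complexity S)
  refutation (_▷_ {k} {prev} {Φ} P J) {S} treeLike last≡1 size≡S =
    certs (P ▷ J) k , bounded , coeffs (vanishes certified) , coeffs (derives certified)
    where
    certified : certs (P ▷ J) k ⊩ cst 1#
    certified = ≡.subst₂ _⊩_ (≡.sym (update-≡ k _ (certs P))) (≡.trans (≡.sym (Vecₚ.last-∷ʳ Φ prev)) last≡1)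
                              (lineCert-⊩ (certs P) (certs-⊩ P) J)

    acc = accounted (P ▷ J) treeLike (ℕₚ.≤-reflexive size≡S)

    bounded : size (certs (P ▷ J) k) ≤ evalPoly complexity S
    bounded = begin
      size (certs (P ▷ J) k)              ≤⟨ paid acc k ℕₚ.≤-refl (last-unused P J) ⟩
      weights (P ▷ J) k                   ≤⟨ ℕₚ.m≤n+m _ _ ⟩
      total (suc k) (weights (P ▷ J))     ≤⟨ budget acc ⟩
      suc k ℕ.* perLine S                 ≤⟨ ℕₚ.*-monoˡ-≤ _ (ℕₚ.≤-trans (length≤proofSize (prev Vec.∷ʳ Φ)) (ℕₚ.≤-reflexive size≡S)) ⟩
      S ℕ.* perLine S                     ≡⟨ complexity-eval S ⟩
      evalPoly complexity S               ∎

theorem4p4 : Σ (List ℕ) λ p →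
    (𝔽 : Field) (n m : ℕ) (fs : Vec (Form (Field.Carrier 𝔽) (Fin n)) m) (S : ℕ) →
    TreeLikeRefutation 𝔽 fs S → NCIPSRefutation 𝔽 fs (evalPoly p S)
theorem4p4 = SizeArithmetic.complexity , λ where
  𝔽 n m fs S (_ , _ , P , treeLike , last≡1 , size≡S) →
    LineCertificates.refutation 𝔽 fs P treeLike last≡1 size≡S
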